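{- Let $G$ be a graph on the vertex set $\{1,\dots,n\}$ which has a nice perfect elimination ordering $v_1,\dots,v_n$, and for each $i$ let $e_i$ be the number of neighbors of $v_i$ among $v_1,\dots,v_{i-1}$. Then $R_G(q)=[e_1+1]_q\,[e_2+1]_q\cdots[e_n+1]_q$.
   Context: A perfect elimination ordering of $G$ is an ordering $v_1,\dots,v_n$ of its vertices such that for each $i$, the neighbors of $v_i$ among $v_1,\dots,v_{i-1}$ form a clique. It is nice if moreover, for each $i$, either all neighbors of $v_i$ among $v_1,\dots,v_{i-1}$ are greater than $v_i$ (as integers), or all of them are less than $v_i$. $R_G(q)=\sum_{\mathcal{O}}q^{\mathrm{des}(\mathcal{O})}$, summing over acyclic orientations $\mathcal{O}$ of $G$, where $\mathrm{des}(\mathcal{O})$ is the number of edges oriented $i\to j$ with $i>j$. $[a]_q=1+q+\cdots+q^{a-1}$. -}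

module Defs where

open import Data.Nat using (ℕ; zero; suc; _+_; _*_; _<_)
open import Data.Bool using (Bool; true; false; if_then_else_; _∧_)
open import Data.Fin using (Fin; toℕ)
open import Data.Fin.Permutation using (Permutation′; _⟨$⟩ʳ_)
open import Data.List using (List; []; _∷_; map; foldr; allFin; replicate)
open import Data.Nat.ListAction using (sum)
open import Data.Vec using (Vec; lookup)
open import Data.Sum using (_⊎_)
open import Data.Product using (_×_)
open import Relation.Nullary using (¬_)
open import Relation.Binary.PropositionalEquality using (_≡_; _≢_)
open import Relation.Binary.Construct.Closure.Transitive using (TransClosure)

-- Finite simple graphs on the vertex set Fin n (vertex i ∈ Fin n stands
-- for the integer toℕ i + 1 ∈ {1,…,n}; the order is preserved).

record Graph (n : ℕ) : Set where
  field
    adj   : Fin n → Fin n → Bool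
    sym   : ∀ i j → adj i j ≡ adj j i
    irrefl : ∀ i → adj i i ≡ false

open Graph public

Adj : ∀ {n} → Graph n → Fin n → Fin n → Set
Adj G i j = adj G i j ≡ true

-- Orderings v₁,…,vₙ given as a permutation σ (v at position i is σ ⟨$⟩ʳ i).

IsPEO : ∀ {n} → Graph n → Permutation′ n → Set
IsPEO {n} G σ = ∀ (i j k : Fin n) → toℕ j < toℕ i → toℕ k < toℕ i → j ≢ k →
  Adj G (σ ⟨$⟩ʳ i) (σ ⟨$⟩ʳ j) → Adj G (σ ⟨$⟩ʳ i) (σ ⟨$⟩ʳ k) →
  Adj G (σ ⟨$⟩ʳ j) (σ ⟨$⟩ʳ k)

IsNicePEO : ∀ {n} → Graph n → Permutation′ n → Set
IsNicePEO {n} G σ = IsPEO G σ × (∀ (i : Fin n) →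
  (∀ (j : Fin n) → toℕ j < toℕ i → Adj G (σ ⟨$⟩ʳ i) (σ ⟨$⟩ʳ j) →
      toℕ (σ ⟨$⟩ʳ i) < toℕ (σ ⟨$⟩ʳ j))
  ⊎
  (∀ (j : Fin n) → toℕ j < toℕ i → Adj G (σ ⟨$⟩ʳ i) (σ ⟨$⟩ʳ j) →
      toℕ (σ ⟨$⟩ʳ j) < toℕ (σ ⟨$⟩ʳ i)))

_<ᵇ'_ : ℕ → ℕ → Bool
_ <ᵇ' zero = false
zero <ᵇ' suc _ = true
suc m <ᵇ' suc n = m <ᵇ' n

count : ∀ {A : Set} → (A → Bool) → List A → ℕ
count p xs = sum (map (λ x → if p x then 1 else 0) xs)

earlierDeg : ∀ {n} → Graph n → Permutation′ n → Fin n → ℕ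
earlierDeg G σ i =
  count (λ j → (toℕ j <ᵇ' toℕ i) ∧ adj G (σ ⟨$⟩ʳ i) (σ ⟨$⟩ʳ j)) (allFin _)

-- Polynomials in q with ℕ coefficients, as coefficient lists (constant first).

Poly : Set
Poly = List ℕ

_⊕_ : Poly → Poly → Poly
[] ⊕ q = q
(a ∷ p) ⊕ [] = a ∷ p
(a ∷ p) ⊕ (b ∷ q) = (a + b) ∷ (p ⊕ q)

_⊛_ : Poly → Poly → Poly
[] ⊛ q = []
(a ∷ p) ⊛ q = map (a *_) q ⊕ (0 ∷ (p ⊛ q))

coeff : Poly → ℕ → ℕ
coeff [] k = 0
coeff (a ∷ p) zero = a
coeff (a ∷ p) (suc k) = coeff p k

qInt : ℕ → Poly
qInt a = replicate a 1

-- Orientations of G: an n×n Boolean matrix o, o[i][j] = true meaning the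
-- edge {i,j} is oriented i → j.

Arc : ∀ {n} → Vec (Vec Bool n) n → Fin n → Fin n → Set
Arc o i j = lookup (lookup o i) j ≡ true

IsOrientation : ∀ {n} → Graph n → Vec (Vec Bool n) n → Set
IsOrientation G o =
  (∀ i j → Arc o i j → Adj G i j) ×
  (∀ i j → Adj G i j → Arc o i j ⊎ Arc o j i) ×
  (∀ i j → Arc o i j → ¬ Arc o j i)

IsAcyclic : ∀ {n} → Vec (Vec Bool n) n → Set
IsAcyclic o = ∀ i → ¬ TransClosure (Arc o) i i

des : ∀ {n} → Vec (Vec Bool n) n → ℕ
des {n} o = sum (map (λ i → count (λ j → (toℕ j <ᵇ' toℕ i) ∧ lookup (lookup o i) j)
                                (allFin n))
                  (allFin n))

-- Proof.  (1) For a perfect elimination ordering, an acyclic orientation o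
-- is determined by its in-degrees d_k (arcs into v_k from earlier
-- neighbours), and every d with d_k ≤ e_k occurs.  Decoding d ranks the
-- positions one at a time, inserting position k at the first rank with d_k
-- of its earlier neighbours below it, and directs each edge towards the
-- larger rank (Decode).  Conversely the earlier neighbours of v_k form a
-- clique, totally ordered by o, and the arcs into v_k come from a down-set
-- of size d_k of that chain: the one chosen by the decoding (Encode).
-- (2) Niceness makes the edges from v_k to earlier neighbours descents
-- exactly when they point into v_k, or exactly when they point out of it;
-- so des o = Σ c_k with c_k = d_k or e_k ∸ d_k (des-formula).
-- (3) The vectors c with c_k ≤ e_k and Σ c_k = K are counted by the
-- coefficient of q^K in ∏ [e_k+1]_q (count-box).

module Submission where

open import Defs renaming (sym to adj-sym; irrefl to adj-irrefl)
open import Data.Nat using (ℕ; zero; suc; _+_; _*_; _∸_; _≤_; _<_; z≤n; s≤s; s≤s⁻¹)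
open import Data.Nat.Properties
open import Data.Nat.ListAction using (sum)
open import Data.Bool using (Bool; true; false; if_then_else_; _∧_; not)
open import Data.Bool.Properties using (∧-conicalˡ; ∧-conicalʳ; ∧-zeroʳ)
open import Data.Fin as Fin using (Fin; zero; suc; toℕ; fromℕ<)
open import Data.Fin.Properties using (toℕ-injective; toℕ<n; toℕ-fromℕ<; fromℕ<-toℕ)
import Data.Fin.Properties as Finₚ
open import Data.Fin.Permutation using (Permutation′; _⟨$⟩ʳ_; _⟨$⟩ˡ_; inverseˡ; inverseʳ)
open import Data.List as List
  using (List; []; _∷_; map; foldr; allFin; length; replicate; _++_; upTo; applyUpTo; filter; cartesianProductWith)
open import Data.List.Properties
  using (map-tabulate; map-cong; map-id; map-∘; map-upTo; length-map; length-++; filter-++; filter-none; filter-≐)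
open import Data.List.Membership.Propositional using (_∈_)
open import Data.List.Membership.Propositional.Properties
  using (∈-upTo⁺; ∈-upTo⁻; ∈-cartesianProductWith⁺; ∈-cartesianProductWith⁻;
         ∈-map⁺; ∈-map⁻; ∈-filter⁺; ∈-filter⁻)
open import Data.List.Relation.Unary.Any using (here; there)
open import Data.List.Relation.Unary.All using (All; []; _∷_; universal)
open import Data.List.Relation.Unary.AllPairs using ([]; _∷_)
open import Data.List.Relation.Unary.Unique.Propositional using (Unique)
open import Data.List.Relation.Unary.Unique.Propositional.Properties using (upTo⁺; cartesianProductWith⁺; filter⁺)
open import Data.Vec as Vec using (Vec; lookup; tabulate) renaming ([] to []ᵥ; _∷_ to _∷ᵥ_)
open import Data.Vec.Properties using (∷-injective; lookup∘tabulate; tabulate∘lookup; tabulate-cong)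
open import Data.Product using (Σ; ∃; _×_; _,_; proj₁; proj₂)
open import Data.Sum using (_⊎_; inj₁; inj₂; [_,_]′)
open import Relation.Nullary using (¬_; yes; no; Dec; does; contradiction)
open import Relation.Nullary.Decidable using (dec-true; dec-false; dec-yes)
open import Relation.Unary using (Decidable)
open import Relation.Binary using (tri<; tri≈; tri>)
open import Relation.Binary.Construct.Closure.Transitive using (TransClosure; [_]; _∷_)
open import Relation.Binary.PropositionalEquality
  using (_≡_; _≢_; refl; trans; cong; cong₂; subst; subst₂; module ≡-Reasoning) renaming (sym to ≡-sym)
open import Function using (_∘_; id; const)
open import Function.Bundles using (_⇔_; mk⇔)
import Algebra.Properties.CommutativeMonoid.Sum as CommutativeMonoidSum

<ᵇ'⇒< : ∀ m n → m <ᵇ' n ≡ true → m < n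
<ᵇ'⇒< zero    (suc n) _ = s≤s z≤n
<ᵇ'⇒< (suc m) (suc n) e = s≤s (<ᵇ'⇒< m n e)

<⇒<ᵇ' : ∀ {m n} → m < n → m <ᵇ' n ≡ true
<⇒<ᵇ' {zero}  (s≤s _) = refl
<⇒<ᵇ' {suc m} (s≤s p) = <⇒<ᵇ' p

≮ᵇ'⇒≥ : ∀ m n → m <ᵇ' n ≡ false → n ≤ m
≮ᵇ'⇒≥ m       zero    _ = z≤n
≮ᵇ'⇒≥ (suc m) (suc n) e = s≤s (≮ᵇ'⇒≥ m n e)

≥⇒≮ᵇ' : ∀ {m n} → n ≤ m → m <ᵇ' n ≡ false
≥⇒≮ᵇ' z≤n     = refl
≥⇒≮ᵇ' (s≤s p) = ≥⇒≮ᵇ' p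

from-does : ∀ {A : Set} (a? : Dec A) → does a? ≡ true → A
from-does (yes a) _ = a

open CommutativeMonoidSum +-0-commutativeMonoid
  using (∑-distrib-+; ∑-comm; ∑-permute; sum-replicate-zero)
  renaming (sum to ∑; sum-cong-≗ to ∑-cong)

ind : Bool → ℕ
ind b = if b then 1 else 0

card : ∀ {m} → (Fin m → Bool) → ℕ
card p = ∑ (ind ∘ p)

sum-map-tabulate : ∀ {m} {A : Set} (f : A → ℕ) (g : Fin m → A) →
  sum (map f (List.tabulate g)) ≡ ∑ (f ∘ g)
sum-map-tabulate {zero}  f g = refl
sum-map-tabulate {suc m} f g = cong (f (g zero) +_) (sum-map-tabulate f (g ∘ suc))

count-allFin : ∀ {m} (p : Fin m → Bool) → count p (allFin m) ≡ card p
count-allFin p = sum-map-tabulate (ind ∘ p) id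

ind-mono : ∀ {a b} → (a ≡ true → b ≡ true) → ind a ≤ ind b
ind-mono {false} _ = z≤n
ind-mono {true}  h rewrite h refl = ≤-refl

∑-mono-≤ : ∀ {m} {f g : Fin m → ℕ} → (∀ i → f i ≤ g i) → ∑ f ≤ ∑ g
∑-mono-≤ {zero}  _ = z≤n
∑-mono-≤ {suc m} h = +-mono-≤ (h zero) (∑-mono-≤ (h ∘ suc))

card-none : ∀ {m} (p : Fin m → Bool) → (∀ i → p i ≡ false) → card p ≡ 0
card-none {m} p none = trans (∑-cong (λ i → cong ind (none i))) (sum-replicate-zero m)

card-≤1 : ∀ {m} (p : Fin m → Bool) → (∀ i j → p i ≡ true → p j ≡ true → i ≡ j) →
  card p ≤ 1
card-≤1 {zero}  p _ = z≤n
card-≤1 {suc m} p unique with p zero in p0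
... | false = card-≤1 (p ∘ suc) (λ i j pi pj → Finₚ.suc-injective (unique (suc i) (suc j) pi pj))
... | true  = ≤-reflexive (cong suc (card-none (p ∘ suc) rest-empty))
  where
  rest-empty : ∀ i → p (suc i) ≡ false
  rest-empty i with p (suc i) in pi
  ... | false = refl
  ... | true  = contradiction (unique zero (suc i) p0 pi) (λ ())

⊆-card⇒≡ : ∀ {m} (A B : Fin m → Bool) → (∀ i → B i ≡ true → A i ≡ true) →
  card A ≡ card B → ∀ i → A i ≡ B i
⊆-card⇒≡ {suc m} A B B⊆A eq i with A zero in a0 | B zero in b0 | i
... | true  | true  | zero   = trans a0 (≡-sym b0)
... | true  | true  | suc i′ = ⊆-card⇒≡ (A ∘ suc) (B ∘ suc) (B⊆A ∘ suc) (suc-injective eq) i′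
... | false | false | zero   = trans a0 (≡-sym b0)
... | false | false | suc i′ = ⊆-card⇒≡ (A ∘ suc) (B ∘ suc) (B⊆A ∘ suc) eq i′
... | false | true  | _      = contradiction (trans (≡-sym (B⊆A zero b0)) a0) (λ ())
... | true  | false | _      = contradiction
  (subst (_≤ card (A ∘ suc)) (≡-sym eq) (∑-mono-≤ {f = ind ∘ B ∘ suc} (ind-mono ∘ B⊆A ∘ suc)))
  (<⇒≱ ≤-refl)

module Chain {m} (C : Fin m → Bool) (r : Fin m → ℕ)
  (r-injective : ∀ i j → C i ≡ true → C j ≡ true → r i ≡ r j → i ≡ j) where

  IsDownSet : (Fin m → Bool) → Set
  IsDownSet X = (∀ i → X i ≡ true → C i ≡ true) ×
                (∀ i j → X i ≡ true → C j ≡ true → r j < r i → X j ≡ true)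

  downSet-⊇ : ∀ {X Y} → IsDownSet X → IsDownSet Y → ∀ i → X i ≡ true → Y i ≡ false →
    ∀ j → Y j ≡ true → X j ≡ true
  downSet-⊇ (X⊆C , X-down) (Y⊆C , Y-down) i xi yi j yj with <-cmp (r j) (r i)
  ... | tri< j<i _ _ = X-down i j xi (Y⊆C j yj) j<i
  ... | tri≈ _ j≈i _ with r-injective j i (Y⊆C j yj) (X⊆C i xi) j≈i
  ...   | refl = contradiction (trans (≡-sym yj) yi) (λ ())
  downSet-⊇ (X⊆C , X-down) (Y⊆C , Y-down) i xi yi j yj | tri> _ _ i<j =
    contradiction (trans (≡-sym (Y-down j i yj (X⊆C i xi) i<j)) yi) (λ ())

  downSets-≡ : ∀ {X Y} → IsDownSet X → IsDownSet Y → card X ≡ card Y → ∀ i → X i ≡ Y i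
  downSets-≡ {X} {Y} dX dY eq i with X i in xi | Y i in yi
  ... | true  | true  = refl
  ... | false | false = refl
  ... | true  | false = contradiction
    (trans (≡-sym xi) (trans (⊆-card⇒≡ X Y (downSet-⊇ dX dY i xi yi) eq i) yi)) (λ ())
  ... | false | true  = contradiction
    (trans (≡-sym yi) (trans (⊆-card⇒≡ Y X (downSet-⊇ dY dX i yi xi) (≡-sym eq) i) xi)) (λ ())

when : Bool → ℕ → ℕ
when c x = if c then x else 0

when-+ : ∀ c x y → when c x + when c y ≡ when c (x + y)
when-+ true  x y = refl
when-+ false x y = refl

∑∑-lowerTriangle : ∀ {m} (f : Fin m → Fin m → ℕ) → (∀ a → f a a ≡ 0) →
  ∑ (λ a → ∑ (λ b → f a b)) ≡
  ∑ (λ a → ∑ (λ b → when (toℕ b <ᵇ' toℕ a) (f a b + f b a)))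
∑∑-lowerTriangle {m} f f-diag = begin
  ∑ (λ a → ∑ (λ b → f a b))
    ≡⟨ ∑-cong (λ a → trans (∑-cong (split a)) (∑-distrib-+ (below a) (above a))) ⟩
  ∑ (λ a → ∑ (below a) + ∑ (above a))
    ≡⟨ ∑-distrib-+ (λ a → ∑ (below a)) (λ a → ∑ (above a)) ⟩
  ∑ (λ a → ∑ (below a)) + ∑ (λ a → ∑ (above a))
    ≡⟨ cong (∑ (λ a → ∑ (below a)) +_) (∑-comm above) ⟩
  ∑ (λ a → ∑ (below a)) + ∑ (λ a → ∑ (λ b → above b a))
    ≡⟨ ≡-sym (∑-distrib-+ (λ a → ∑ (below a)) (λ a → ∑ (λ b → above b a))) ⟩
  ∑ (λ a → ∑ (below a) + ∑ (λ b → above b a))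
    ≡⟨ ∑-cong (λ a → ≡-sym (∑-distrib-+ (below a) (λ b → above b a))) ⟩
  ∑ (λ a → ∑ (λ b → below a b + above b a))
    ≡⟨ ∑-cong (λ a → ∑-cong (λ b → when-+ (toℕ b <ᵇ' toℕ a) (f a b) (f b a))) ⟩
  ∑ (λ a → ∑ (λ b → when (toℕ b <ᵇ' toℕ a) (f a b + f b a))) ∎
  where
  open ≡-Reasoning
  below above : Fin m → Fin m → ℕ
  below a b = when (toℕ b <ᵇ' toℕ a) (f a b)
  above a b = when (toℕ a <ᵇ' toℕ b) (f a b)
  split : ∀ a b → f a b ≡ below a b + above a b
  split a b with <-cmp (toℕ a) (toℕ b)
  ... | tri< a<b _ _ rewrite ≥⇒≮ᵇ' (<⇒≤ a<b) | <⇒<ᵇ' a<b = refl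
  ... | tri> _ _ b<a rewrite ≥⇒≮ᵇ' (<⇒≤ b<a) | <⇒<ᵇ' b<a = ≡-sym (+-identityʳ _)
  ... | tri≈ _ a≈b _ with toℕ-injective a≈b
  ...   | refl rewrite ≥⇒≮ᵇ' (≤-refl {toℕ a}) = f-diag a

-- The first point of [0, r] satisfying g (and r if there is none).
search : (ℕ → Bool) → ℕ → ℕ
search g zero    = 0
search g (suc r) = if g 0 then 0 else suc (search (g ∘ suc) r)

search-≤ : ∀ (g : ℕ → Bool) r → search g r ≤ r
search-≤ g zero    = z≤n
search-≤ g (suc r) with g 0
... | true  = z≤n
... | false = s≤s (search-≤ (g ∘ suc) r)

search-finds : ∀ (g : ℕ → Bool) r q → q ≤ r → g q ≡ true → g (search g r) ≡ true
search-finds g zero    zero    _         gq = gq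
search-finds g (suc r) zero    _         gq rewrite gq = gq
search-finds g (suc r) (suc q) (s≤s q≤r) gq with g 0 in g0
... | true  = g0
... | false = search-finds (g ∘ suc) r q q≤r gq

unitSteps-attain : (f : ℕ → ℕ) → f 0 ≡ 0 → (∀ p → f (suc p) ≤ suc (f p)) →
  ∀ N a → a ≤ f N → ∃ λ q → q ≤ N × f q ≡ a
unitSteps-attain f f0 step zero a a≤ = 0 , z≤n , trans f0 (≡-sym (n≤0⇒n≡0 (subst (a ≤_) f0 a≤)))
unitSteps-attain f f0 step (suc N) a a≤ with a ≤? f N
... | yes a≤fN = let (q , q≤N , fq) = unitSteps-attain f f0 step N a a≤fN in q , m≤n⇒m≤1+n q≤N , fq
... | no  a≰fN = suc N , ≤-refl , ≤-antisym (≤-trans (step N) (≰⇒> a≰fN)) a≤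

coeff-⊕ : ∀ P Q k → coeff (P ⊕ Q) k ≡ coeff P k + coeff Q k
coeff-⊕ []      Q       k       = refl
coeff-⊕ (a ∷ P) []      zero    = ≡-sym (+-identityʳ a)
coeff-⊕ (a ∷ P) []      (suc k) = ≡-sym (+-identityʳ _)
coeff-⊕ (a ∷ P) (b ∷ Q) zero    = refl
coeff-⊕ (a ∷ P) (b ∷ Q) (suc k) = coeff-⊕ P Q k

shiftBy : ℕ → Poly → Poly
shiftBy a P = replicate a 0 ++ P

coeff-qInt-⊛ : ∀ b P k → coeff (qInt b ⊛ P) k ≡ sum (map (λ a → coeff (shiftBy a P) k) (upTo b))
coeff-qInt-⊛ zero    P k = refl
coeff-qInt-⊛ (suc b) P k = begin
  coeff (map (1 *_) P ⊕ (0 ∷ (qInt b ⊛ P))) k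
    ≡⟨ coeff-⊕ (map (1 *_) P) _ k ⟩
  coeff (map (1 *_) P) k + coeff (0 ∷ (qInt b ⊛ P)) k
    ≡⟨ cong₂ _+_ (cong (λ Q → coeff Q k) (trans (map-cong *-identityˡ P) (map-id P))) (higher k) ⟩
  coeff P k + sum (map (h ∘ suc) (upTo b))
    ≡⟨ cong (λ xs → coeff P k + sum xs) (trans (map-∘ (upTo b)) (cong (map h) (map-upTo suc b))) ⟩
  coeff P k + sum (map h (applyUpTo suc b)) ∎
  where
  open ≡-Reasoning
  h : ℕ → ℕ
  h a = coeff (shiftBy a P) k
  zeros : (xs : List ℕ) → sum (map (λ _ → 0) xs) ≡ 0
  zeros []       = refl
  zeros (_ ∷ xs) = zeros xs
  higher : ∀ j → coeff (0 ∷ (qInt b ⊛ P)) j ≡ sum (map (λ a → coeff (shiftBy (suc a) P) j) (upTo b))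
  higher zero    = ≡-sym (zeros (upTo b))
  higher (suc j) = coeff-qInt-⊛ b P j

module _ {A B C : Set} {P : C → Set} (P? : Decidable P) where

  length-filter-map : (g : B → C) (ys : List B) →
    length (filter P? (map g ys)) ≡ length (filter (P? ∘ g) ys)
  length-filter-map g []       = refl
  length-filter-map g (y ∷ ys) with does (P? (g y))
  ... | true  = cong suc (length-filter-map g ys)
  ... | false = length-filter-map g ys

  length-filter-cartesian : (f : A → B → C) (xs : List A) (ys : List B) →
    length (filter P? (cartesianProductWith f xs ys)) ≡
    sum (map (λ x → length (filter (P? ∘ f x) ys)) xs)
  length-filter-cartesian f []       ys = refl
  length-filter-cartesian f (x ∷ xs) ys = begin
    length (filter P? (map (f x) ys ++ cartesianProductWith f xs ys))
      ≡⟨ cong length (filter-++ P? (map (f x) ys) _) ⟩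
    length (filter P? (map (f x) ys) ++ filter P? (cartesianProductWith f xs ys))
      ≡⟨ length-++ (filter P? (map (f x) ys)) ⟩
    length (filter P? (map (f x) ys)) + length (filter P? (cartesianProductWith f xs ys))
      ≡⟨ cong₂ _+_ (length-filter-map (f x) ys) (length-filter-cartesian f xs ys) ⟩
    length (filter (P? ∘ f x) ys) + sum (map (λ x → length (filter (P? ∘ f x) ys)) xs) ∎
    where open ≡-Reasoning

count-shifted : ∀ {A : Set} (w : A → ℕ) (xs : List A) (Q : Poly) →
  (∀ K → length (filter (λ x → w x ≟ K) xs) ≡ coeff Q K) →
  ∀ a K → length (filter (λ x → a + w x ≟ K) xs) ≡ coeff (shiftBy a Q) K
count-shifted w xs Q counts zero    K       = counts K
count-shifted w xs Q counts (suc a) zero    =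
  cong length (filter-none (λ x → suc a + w x ≟ 0) (universal (λ _ ()) xs))
count-shifted w xs Q counts (suc a) (suc K) = trans
  (cong length (filter-≐ (λ x → suc a + w x ≟ suc K) (λ x → a + w x ≟ K) (suc-injective , cong suc) xs))
  (count-shifted w xs Q counts a K)

box : ∀ {m} → Vec ℕ m → List (Vec ℕ m)
box []ᵥ       = []ᵥ ∷ []
box (b ∷ᵥ bs) = cartesianProductWith _∷ᵥ_ (upTo (suc b)) (box bs)

qProduct : ∀ {m} → Vec ℕ m → Poly
qProduct []ᵥ       = 1 ∷ []
qProduct (b ∷ᵥ bs) = qInt (suc b) ⊛ qProduct bs

count-box : ∀ {m} (bs : Vec ℕ m) K →
  length (filter (λ c → Vec.sum c ≟ K) (box bs)) ≡ coeff (qProduct bs) K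
count-box []ᵥ       zero    = refl
count-box []ᵥ       (suc K) = refl
count-box (b ∷ᵥ bs) K = begin
  length (filter (λ c → Vec.sum c ≟ K) (cartesianProductWith _∷ᵥ_ (upTo (suc b)) (box bs)))
    ≡⟨ length-filter-cartesian (λ c → Vec.sum c ≟ K) _∷ᵥ_ (upTo (suc b)) (box bs) ⟩
  sum (map (λ a → length (filter (λ c → a + Vec.sum c ≟ K) (box bs))) (upTo (suc b)))
    ≡⟨ cong sum (map-cong (λ a → count-shifted Vec.sum (box bs) (qProduct bs) (count-box bs) a K)
                          (upTo (suc b))) ⟩
  sum (map (λ a → coeff (shiftBy a (qProduct bs)) K) (upTo (suc b)))
    ≡⟨ ≡-sym (coeff-qInt-⊛ (suc b) (qProduct bs) K) ⟩
  coeff (qInt (suc b) ⊛ qProduct bs) K ∎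
  where open ≡-Reasoning

∈-box⁺ : ∀ {m} (bs c : Vec ℕ m) → (∀ k → lookup c k ≤ lookup bs k) → c ∈ box bs
∈-box⁺ []ᵥ       []ᵥ       _ = here refl
∈-box⁺ (b ∷ᵥ bs) (a ∷ᵥ c) c≤bs =
  ∈-cartesianProductWith⁺ _∷ᵥ_ (∈-upTo⁺ (s≤s (c≤bs zero))) (∈-box⁺ bs c (c≤bs ∘ suc))

∈-box⁻ : ∀ {m} (bs : Vec ℕ m) {c} → c ∈ box bs → ∀ k → lookup c k ≤ lookup bs k
∈-box⁻ (b ∷ᵥ bs) c∈ k with ∈-cartesianProductWith⁻ _∷ᵥ_ (upTo (suc b)) (box bs) c∈
∈-box⁻ (b ∷ᵥ bs) c∈ zero    | a , c , a∈ , _ , refl = s≤s⁻¹ (∈-upTo⁻ a∈)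
∈-box⁻ (b ∷ᵥ bs) c∈ (suc k) | a , c , _ , c∈′ , refl = ∈-box⁻ bs c∈′ k

box-unique : ∀ {m} (bs : Vec ℕ m) → Unique (box bs)
box-unique []ᵥ       = [] ∷ []
box-unique (b ∷ᵥ bs) = cartesianProductWith⁺ _∷ᵥ_ ∷-injective (upTo⁺ (suc b)) (box-unique bs)

qProduct-tabulate : ∀ {m} (g : Fin m → ℕ) →
  qProduct (Vec.tabulate g) ≡ foldr _⊛_ (1 ∷ []) (map (λ i → qInt (g i + 1)) (allFin m))
qProduct-tabulate g =
  trans (as-tabulate g) (cong (foldr _⊛_ (1 ∷ [])) (≡-sym (map-tabulate id (λ i → qInt (g i + 1)))))
  where
  as-tabulate : ∀ {m} (g : Fin m → ℕ) →
    qProduct (Vec.tabulate g) ≡ foldr _⊛_ (1 ∷ []) (List.tabulate (λ i → qInt (g i + 1)))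
  as-tabulate {zero}  g = refl
  as-tabulate {suc m} g = cong₂ _⊛_ (cong qInt (+-comm 1 (g zero))) (as-tabulate (g ∘ suc))

Orientation : ℕ → Set
Orientation n = Vec (Vec Bool n) n

arc : ∀ {n} → Orientation n → Fin n → Fin n → Bool
arc o u w = lookup (lookup o u) w

vec-ext : ∀ {A : Set} {m} (a b : Vec A m) → (∀ k → lookup a k ≡ lookup b k) → a ≡ b
vec-ext a b same = trans (≡-sym (tabulate∘lookup a)) (trans (tabulate-cong same) (tabulate∘lookup b))

matrix-ext : ∀ {n} (o o′ : Orientation n) → (∀ u w → arc o u w ≡ arc o′ u w) → o ≡ o′
matrix-ext o o′ same = vec-ext o o′ (λ u → vec-ext (lookup o u) (lookup o′ u) (same u))

module _ {n} (G : Graph n) where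

  rankOrientation : (Fin n → ℕ) → Orientation n
  rankOrientation ρ = tabulate (λ u → tabulate (λ w → adj G u w ∧ (ρ u <ᵇ' ρ w)))

  arc-rankOrientation : ∀ ρ u w → arc (rankOrientation ρ) u w ≡ (adj G u w ∧ (ρ u <ᵇ' ρ w))
  arc-rankOrientation ρ u w =
    trans (cong (λ row → lookup row w) (lookup∘tabulate _ u)) (lookup∘tabulate _ w)

  arc⇒rank< : ∀ ρ u w → Arc (rankOrientation ρ) u w → ρ u < ρ w
  arc⇒rank< ρ u w a = <ᵇ'⇒< (ρ u) (ρ w) (∧-conicalʳ _ _ (trans (≡-sym (arc-rankOrientation ρ u w)) a))

  rankOrientation-acyclic : ∀ ρ → IsAcyclic (rankOrientation ρ)
  rankOrientation-acyclic ρ u cycle = <-irrefl refl (increasing cycle)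
    where
    increasing : ∀ {x y} → TransClosure (Arc (rankOrientation ρ)) x y → ρ x < ρ y
    increasing [ a ]   = arc⇒rank< ρ _ _ a
    increasing (a ∷ p) = <-trans (arc⇒rank< ρ _ _ a) (increasing p)

  rankOrientation-isOrientation : ∀ ρ → (∀ u w → ρ u ≡ ρ w → u ≡ w) →
    IsOrientation G (rankOrientation ρ)
  rankOrientation-isOrientation ρ ρ-injective = arc⇒edge , edge⇒arc , antisymmetric
    where
    ρ<⇒arc : ∀ u w → ρ u < ρ w → Adj G u w → arc (rankOrientation ρ) u w ≡ true
    ρ<⇒arc u w ρu<ρw e rewrite arc-rankOrientation ρ u w | e = <⇒<ᵇ' ρu<ρw
    arc⇒edge : ∀ u w → Arc (rankOrientation ρ) u w → Adj G u w
    arc⇒edge u w a = ∧-conicalˡ _ _ (trans (≡-sym (arc-rankOrientation ρ u w)) a)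
    edge⇒arc : ∀ u w → Adj G u w → Arc (rankOrientation ρ) u w ⊎ Arc (rankOrientation ρ) w u
    edge⇒arc u w e with <-cmp (ρ u) (ρ w)
    ... | tri< u<w _ _ = inj₁ (ρ<⇒arc u w u<w e)
    ... | tri> _ _ w<u = inj₂ (ρ<⇒arc w u w<u (trans (adj-sym G w u) e))
    ... | tri≈ _ u≈w _ with ρ-injective u w u≈w
    ...   | refl = contradiction (trans (≡-sym (adj-irrefl G u)) e) (λ ())
    antisymmetric : ∀ u w → Arc (rankOrientation ρ) u w → ¬ Arc (rankOrientation ρ) w u
    antisymmetric u w uw wu = <-asym (arc⇒rank< ρ u w uw) (arc⇒rank< ρ w u wu)

  module _ (o : Orientation n) (o-orientation : IsOrientation G o) where

    arc-nonEdge : ∀ u w → adj G u w ≡ false → arc o u w ≡ false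
    arc-nonEdge u w non-edge with arc o u w in a
    ... | false = refl
    ... | true  = contradiction (trans (≡-sym non-edge) (proj₁ o-orientation u w a)) (λ ())

    arc-flip : ∀ u w → Adj G u w → arc o u w ≡ not (arc o w u)
    arc-flip u w e with arc o u w in uw | arc o w u in wu
    ... | true  | true  = contradiction wu (proj₂ (proj₂ o-orientation) u w uw)
    ... | true  | false = refl
    ... | false | true  = refl
    ... | false | false with proj₁ (proj₂ o-orientation) u w e
    ...   | inj₁ uw′ = contradiction (trans (≡-sym uw) uw′) (λ ())
    ...   | inj₂ wu′ = contradiction (trans (≡-sym wu) wu′) (λ ())

    arc-transitive : IsAcyclic o → ∀ a b d → Arc o a b → Arc o b d → Adj G a d → Arc o a d
    arc-transitive acyclic a b d ab bd e with arc o a d in ad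
    ... | true  = refl
    ... | false = contradiction (ab ∷ bd ∷ [ da ]) (acyclic a)
      where
      da : Arc o d a
      da = trans (arc-flip d a (trans (adj-sym G d a) e)) (cong not ad)

-- Inserting a new rank P into a ranking: ranks from P on move up by one.
shift : ℕ → ℕ → ℕ
shift P x = if x <ᵇ' P then x else suc x

shift-<ᵇ'-P : ∀ P x → (shift P x <ᵇ' P) ≡ (x <ᵇ' P)
shift-<ᵇ'-P P x with x <ᵇ' P in x<P
... | true  = x<P
... | false = ≥⇒≮ᵇ' (m≤n⇒m≤1+n (≮ᵇ'⇒≥ x P x<P))

P-<ᵇ'-shift : ∀ P x → (P <ᵇ' shift P x) ≡ not (x <ᵇ' P)
P-<ᵇ'-shift P x with x <ᵇ' P in x<P
... | true  = ≥⇒≮ᵇ' (<⇒≤ (<ᵇ'⇒< x P x<P))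
... | false = <⇒<ᵇ' (s≤s (≮ᵇ'⇒≥ x P x<P))

shift-≢-P : ∀ P x → shift P x ≢ P
shift-≢-P P x e with x <ᵇ' P in x<P
... | true  = <-irrefl e (<ᵇ'⇒< x P x<P)
... | false = <-irrefl (≡-sym e) (s≤s (≮ᵇ'⇒≥ x P x<P))

shift-≤ : ∀ P x → shift P x ≤ suc x
shift-≤ P x with x <ᵇ' P
... | true  = n≤1+n x
... | false = ≤-refl

shift-<ᵇ' : ∀ P x y → (shift P x <ᵇ' shift P y) ≡ (x <ᵇ' y)
shift-<ᵇ' P x y with x <ᵇ' P in x<P | y <ᵇ' P in y<P
... | true  | true  = refl
... | false | false = refl
... | true  | false = trans
  (<⇒<ᵇ' (<-≤-trans (<ᵇ'⇒< x P x<P) (m≤n⇒m≤1+n (≮ᵇ'⇒≥ y P y<P))))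
  (≡-sym (<⇒<ᵇ' (<-≤-trans (<ᵇ'⇒< x P x<P) (≮ᵇ'⇒≥ y P y<P))))
... | false | true  = trans
  (≥⇒≮ᵇ' (≤-trans (<⇒≤ (<ᵇ'⇒< y P y<P)) (m≤n⇒m≤1+n (≮ᵇ'⇒≥ x P x<P))))
  (≡-sym (≥⇒≮ᵇ' (≤-trans (<⇒≤ (<ᵇ'⇒< y P y<P)) (≮ᵇ'⇒≥ x P x<P))))

shift-injective : ∀ P x y → shift P x ≡ shift P y → x ≡ y
shift-injective P x y e = ≤-antisym (not-below y x (≡-sym e)) (not-below x y e)
  where
  not-below : ∀ a b → shift P a ≡ shift P b → b ≤ a
  not-below a b e′ = ≮ᵇ'⇒≥ a b (trans (≡-sym (shift-<ᵇ' P a b))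
    (subst (λ s → (s <ᵇ' shift P b) ≡ false) (≡-sym e′) (≥⇒≮ᵇ' (≤-refl {shift P b}))))

Ranking : ℕ → Set
Ranking n = Fin n → ℕ

IsRanking : ∀ {n} → ℕ → Ranking n → Set
IsRanking m R = (∀ j → toℕ j < m → R j < m) ×
                (∀ j l → toℕ j < m → toℕ l < m → R j ≡ R l → j ≡ l)

<suc-≢⇒< : ∀ {n} {k l : Fin n} → toℕ l < suc (toℕ k) → l ≢ k → toℕ l < toℕ k
<suc-≢⇒< (s≤s l≤k) l≢k = ≤∧≢⇒< l≤k (l≢k ∘ toℕ-injective)

module Positions {n} (G : Graph n) (σ : Permutation′ n) where

  v : Fin n → Fin n
  v k = σ ⟨$⟩ʳ k

  pos : Fin n → Fin n
  pos u = σ ⟨$⟩ˡ u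

  earlier : Fin n → Fin n → Bool
  earlier k j = (toℕ j <ᵇ' toℕ k) ∧ adj G (v k) (v j)

  earlierDeg-card : ∀ k → earlierDeg G σ k ≡ card (earlier k)
  earlierDeg-card k = count-allFin (earlier k)

  earlier⇒< : ∀ {k j} → earlier k j ≡ true → toℕ j < toℕ k
  earlier⇒< {k} {j} e = <ᵇ'⇒< (toℕ j) (toℕ k) (∧-conicalˡ _ _ e)

  earlier⇒edge : ∀ {k j} → earlier k j ≡ true → Adj G (v j) (v k)
  earlier⇒edge {k} {j} e = trans (adj-sym G (v j) (v k)) (∧-conicalʳ _ _ e)

  earlier-intro : ∀ {k j} → toℕ j < toℕ k → Adj G (v k) (v j) → earlier k j ≡ true
  earlier-intro j<k e rewrite <⇒<ᵇ' j<k = e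

  inDeg : Orientation n → Fin n → ℕ
  inDeg o k = card (λ j → earlier k j ∧ arc o (v j) (v k))

  inDeg-≤ : ∀ o k → inDeg o k ≤ card (earlier k)
  inDeg-≤ o k = ∑-mono-≤ (λ j → ind-mono (∧-conicalˡ (earlier k j) _))

  below : Fin n → Ranking n → ℕ → ℕ
  below k R p = card (λ j → earlier k j ∧ (R j <ᵇ' p))

  module _ (k : Fin n) (R : Ranking n) (R-ranking : IsRanking (toℕ k) R) where

    below-zero : below k R 0 ≡ 0
    below-zero = card-none _ (λ j → ∧-zeroʳ (earlier k j))

    below-step : ∀ p → below k R (suc p) ≤ suc (below k R p)
    below-step p = begin
      below k R (suc p)
        ≤⟨ ∑-mono-≤ (λ j → split (earlier k j) (R j)) ⟩
      ∑ (λ j → ind (earlier k j ∧ (R j <ᵇ' p)) + ind (atP j))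
        ≡⟨ ∑-distrib-+ (λ j → ind (earlier k j ∧ (R j <ᵇ' p))) (ind ∘ atP) ⟩
      below k R p + card atP
        ≤⟨ +-monoʳ-≤ (below k R p) (card-≤1 atP atP-unique) ⟩
      below k R p + 1
        ≡⟨ +-comm (below k R p) 1 ⟩
      suc (below k R p) ∎
      where
      open ≤-Reasoning
      atP : Fin n → Bool
      atP j = earlier k j ∧ does (R j ≟ p)
      atP-unique : ∀ i j → atP i ≡ true → atP j ≡ true → i ≡ j
      atP-unique i j ai aj = proj₂ R-ranking i j
        (earlier⇒< (∧-conicalˡ _ _ ai)) (earlier⇒< (∧-conicalˡ _ _ aj))
        (trans (from-does (R i ≟ p) (∧-conicalʳ _ _ ai))
               (≡-sym (from-does (R j ≟ p) (∧-conicalʳ _ _ aj))))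
      split : ∀ b x → ind (b ∧ (x <ᵇ' suc p)) ≤ ind (b ∧ (x <ᵇ' p)) + ind (b ∧ does (x ≟ p))
      split false x = z≤n
      split true  x with x <ᵇ' suc p in x<1+p
      ... | false = z≤n
      ... | true with m≤n⇒m<n∨m≡n (s≤s⁻¹ (<ᵇ'⇒< x (suc p) x<1+p))
      ...   | inj₁ x<p  rewrite <⇒<ᵇ' x<p = s≤s z≤n
      ...   | inj₂ refl rewrite dec-true (x ≟ x) refl = m≤n+m 1 _

    below-top : below k R (toℕ k) ≡ card (earlier k)
    below-top = ∑-cong pointwise
      where
      pointwise : ∀ j → ind (earlier k j ∧ (R j <ᵇ' toℕ k)) ≡ ind (earlier k j)
      pointwise j with earlier k j in e
      ... | false = refl
      ... | true rewrite <⇒<ᵇ' (proj₁ R-ranking j (earlier⇒< e)) = refl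

    below-attains : ∀ a → a ≤ card (earlier k) → ∃ λ q → q ≤ toℕ k × below k R q ≡ a
    below-attains a a≤ = unitSteps-attain (below k R) below-zero below-step (toℕ k) a
      (subst (a ≤_) (≡-sym below-top) a≤)

  v-pos : ∀ u → v (pos u) ≡ u
  v-pos u = inverseʳ σ

  pos-v : ∀ k → pos (v k) ≡ k
  pos-v k = inverseˡ σ

  -- Decoding a vector c of intended in-degrees: the positions are ranked
  -- one at a time, position k being inserted at the first rank that has
  -- c k of its earlier neighbours below it; the decoded orientation directs
  -- every edge towards the larger final rank.
  module Decode (c : Fin n → ℕ) where

    insertionRank : Fin n → Ranking n → ℕ
    insertionRank k R = search (λ p → does (below k R p ≟ c k)) (toℕ k)

    insert : Fin n → Ranking n → Ranking n
    insert k R j = if does (j Fin.≟ k) then insertionRank k R else shift (insertionRank k R) (R j)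

    insert-self : ∀ k R → insert k R k ≡ insertionRank k R
    insert-self k R rewrite dec-true (k Fin.≟ k) refl = refl

    insert-other : ∀ k R j → j ≢ k → insert k R j ≡ shift (insertionRank k R) (R j)
    insert-other k R j j≢k rewrite dec-false (j Fin.≟ k) j≢k = refl

    insertAt : ∀ {m} → Dec (m < n) → Ranking n → Ranking n
    insertAt (yes m<n) = insert (fromℕ< m<n)
    insertAt (no _)    = id

    ranks : ℕ → Ranking n
    ranks zero    = λ _ → 0
    ranks (suc m) = insertAt (m <? n) (ranks m)

    ranks-step : ∀ k → ranks (suc (toℕ k)) ≡ insert k (ranks (toℕ k))
    ranks-step k with dec-yes (toℕ k <? n) (toℕ<n k)
    ... | k<n , eq = trans (cong (λ d → insertAt d (ranks (toℕ k))) eq)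
                           (cong (λ x → insert x (ranks (toℕ k))) (fromℕ<-toℕ k k<n))

    insertionRank-≤ : ∀ k R → insertionRank k R ≤ toℕ k
    insertionRank-≤ k R = search-≤ _ (toℕ k)

    insert-ranking : ∀ k R → IsRanking (toℕ k) R → IsRanking (suc (toℕ k)) (insert k R)
    insert-ranking k R (R<k , R-injective) = range , injective
      where
      P : ℕ
      P = insertionRank k R
      range : ∀ l → toℕ l < suc (toℕ k) → insert k R l < suc (toℕ k)
      range l l≤k with l Fin.≟ k
      ... | yes refl = s≤s (insertionRank-≤ k R)
      ... | no  l≢k  = s≤s (≤-trans (shift-≤ P (R l)) (R<k l (<suc-≢⇒< l≤k l≢k)))
      injective : ∀ l l′ → toℕ l < suc (toℕ k) → toℕ l′ < suc (toℕ k) →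
        insert k R l ≡ insert k R l′ → l ≡ l′
      injective l l′ l≤k l′≤k e with l Fin.≟ k | l′ Fin.≟ k
      ... | yes refl | yes refl = refl
      ... | yes refl | no l′≢k = contradiction (≡-sym e) (shift-≢-P P (R l′))
      ... | no l≢k   | yes refl = contradiction e (shift-≢-P P (R l))
      ... | no l≢k   | no l′≢k  =
        R-injective l l′ (<suc-≢⇒< l≤k l≢k) (<suc-≢⇒< l′≤k l′≢k) (shift-injective P _ _ e)

    ranks-ranking : ∀ m → m ≤ n → IsRanking m (ranks m)
    ranks-ranking zero    _   = (λ j ()) , (λ j l ())
    ranks-ranking (suc m) m<n with fromℕ< m<n | toℕ-fromℕ< m<n
    ... | k | refl = subst (IsRanking (suc (toℕ k))) (≡-sym (ranks-step k))
      (insert-ranking k _ (ranks-ranking (toℕ k) (<⇒≤ m<n)))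

    insertAt-<ᵇ' : ∀ {m} (d : Dec (m < n)) R j l → toℕ j < m → toℕ l < m →
      (insertAt d R j <ᵇ' insertAt d R l) ≡ (R j <ᵇ' R l)
    insertAt-<ᵇ' (no _)    R j l _   _   = refl
    insertAt-<ᵇ' {m} (yes m<n) R j l j<m l<m = trans
      (cong₂ _<ᵇ'_ (insert-other k R j (new-position (at-k j<m))) (insert-other k R l (new-position (at-k l<m))))
      (shift-<ᵇ' (insertionRank k R) (R j) (R l))
      where
      k : Fin n
      k = fromℕ< m<n
      at-k : ∀ {i} → toℕ i < m → toℕ i < toℕ k
      at-k {i} i<m = subst (toℕ i <_) (≡-sym (toℕ-fromℕ< m<n)) i<m
      new-position : ∀ {i} → toℕ i < toℕ k → i ≢ k
      new-position i<k refl = <-irrefl refl i<k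

    ranks-stable : ∀ d m j l → toℕ j < m → toℕ l < m →
      (ranks (d + m) j <ᵇ' ranks (d + m) l) ≡ (ranks m j <ᵇ' ranks m l)
    ranks-stable zero    m j l j<m l<m = refl
    ranks-stable (suc d) m j l j<m l<m = trans
      (insertAt-<ᵇ' (d + m <? n) (ranks (d + m)) j l
        (≤-trans j<m (m≤n+m m d)) (≤-trans l<m (m≤n+m m d)))
      (ranks-stable d m j l j<m l<m)

    finalRanks : Ranking n
    finalRanks = ranks n

    finalRanks-injective : ∀ j l → finalRanks j ≡ finalRanks l → j ≡ l
    finalRanks-injective j l = proj₂ (ranks-ranking n ≤-refl) j l (toℕ<n j) (toℕ<n l)

    final-<ᵇ' : ∀ k j → toℕ j < toℕ k →
      (finalRanks j <ᵇ' finalRanks k) ≡ (ranks (toℕ k) j <ᵇ' insertionRank k (ranks (toℕ k)))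
    final-<ᵇ' k j j<k = begin
      ranks n j <ᵇ' ranks n k
        ≡⟨ cong (λ m → ranks m j <ᵇ' ranks m k) (≡-sym (m∸n+n≡m (toℕ<n k))) ⟩
      ranks (n ∸ suc (toℕ k) + suc (toℕ k)) j <ᵇ' ranks (n ∸ suc (toℕ k) + suc (toℕ k)) k
        ≡⟨ ranks-stable (n ∸ suc (toℕ k)) (suc (toℕ k)) j k (m≤n⇒m≤1+n j<k) ≤-refl ⟩
      ranks (suc (toℕ k)) j <ᵇ' ranks (suc (toℕ k)) k
        ≡⟨ cong (λ R → R j <ᵇ' R k) (ranks-step k) ⟩
      insert k R j <ᵇ' insert k R k
        ≡⟨ cong₂ _<ᵇ'_ (insert-other k R j (λ { refl → <-irrefl refl j<k })) (insert-self k R) ⟩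
      shift P (R j) <ᵇ' P
        ≡⟨ shift-<ᵇ'-P P (R j) ⟩
      R j <ᵇ' P ∎
      where
      open ≡-Reasoning
      R : Ranking n
      R = ranks (toℕ k)
      P : ℕ
      P = insertionRank k R

    decode : Orientation n
    decode = rankOrientation G (finalRanks ∘ pos)

    decode-isOrientation : IsOrientation G decode
    decode-isOrientation = rankOrientation-isOrientation G (finalRanks ∘ pos) λ u w e →
      trans (≡-sym (v-pos u)) (trans (cong v (finalRanks-injective _ _ e)) (v-pos w))

    decode-acyclic : IsAcyclic decode
    decode-acyclic = rankOrientation-acyclic G (finalRanks ∘ pos)

    insertionRank-spec : ∀ k R → IsRanking (toℕ k) R → c k ≤ card (earlier k) →
      below k R (insertionRank k R) ≡ c k
    insertionRank-spec k R R-ranking c≤ with below-attains k R R-ranking (c k) c≤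
    ... | q , q≤k , below≡c = from-does (_ ≟ c k)
      (search-finds (λ p → does (below k R p ≟ c k)) (toℕ k) q q≤k (dec-true (_ ≟ c k) below≡c))

    decode-inDeg : (∀ k → c k ≤ card (earlier k)) → ∀ k → inDeg decode k ≡ c k
    decode-inDeg admissible k = trans (∑-cong pointwise)
      (insertionRank-spec k R (ranks-ranking (toℕ k) (<⇒≤ (toℕ<n k))) (admissible k))
      where
      R : Ranking n
      R = ranks (toℕ k)
      pointwise : ∀ l → ind (earlier k l ∧ arc decode (v l) (v k)) ≡
                        ind (earlier k l ∧ (R l <ᵇ' insertionRank k R))
      pointwise l with earlier k l in e
      ... | false = refl
      ... | true rewrite arc-rankOrientation G (finalRanks ∘ pos) (v l) (v k)
                       | pos-v l | pos-v k | earlier⇒edge e = cong ind (final-<ᵇ' k l (earlier⇒< e))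

  module Encode (peo : IsPEO G σ) {o : Orientation n} (o-orientation : IsOrientation G o)
    (o-acyclic : IsAcyclic o) (c : Fin n → ℕ) (c≡inDeg : ∀ k → c k ≡ inDeg o k) where

    open Decode c

    Agrees : ℕ → Set
    Agrees m = ∀ j l → toℕ j < m → toℕ l < m → Adj G (v j) (v l) →
      arc o (v j) (v l) ≡ (ranks m j <ᵇ' ranks m l)

    earlier-clique : ∀ k i j → earlier k i ≡ true → earlier k j ≡ true → i ≢ j → Adj G (v i) (v j)
    earlier-clique k i j ei ej i≢j =
      peo k i j (earlier⇒< ei) (earlier⇒< ej) i≢j (∧-conicalʳ _ _ ei) (∧-conicalʳ _ _ ej)

    -- Position k once the earlier positions are ranked in agreement with o:
    -- the earlier neighbours sending an arc into k, and those ranked below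
    -- the insertion rank of k, are both down-sets of the clique of earlier
    -- neighbours ordered by rank, of the same size c k; so they coincide.
    module ArcsInto (k : Fin n) (agrees : Agrees (toℕ k)) where

      R : Ranking n
      R = ranks (toℕ k)
      P : ℕ
      P = insertionRank k R

      R-ranking : IsRanking (toℕ k) R
      R-ranking = ranks-ranking (toℕ k) (<⇒≤ (toℕ<n k))

      open Chain (earlier k) R (λ i j ei ej → proj₂ R-ranking i j (earlier⇒< ei) (earlier⇒< ej))

      into lower : Fin n → Bool
      into  j = earlier k j ∧ arc o (v j) (v k)
      lower j = earlier k j ∧ (R j <ᵇ' P)

      -- an arc into k from i is preceded, by transitivity, by the arc into k
      -- from any lower ranked earlier neighbour j (which sends an arc to i)
      into-closed : ∀ i j → into i ≡ true → earlier k j ≡ true → R j < R i → into j ≡ true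
      into-closed i j ii ej Rj<Ri rewrite ej =
        arc-transitive G o o-orientation o-acyclic (v j) (v i) (v k) j→i (∧-conicalʳ _ _ ii) (earlier⇒edge ej)
        where
        ei : earlier k i ≡ true
        ei = ∧-conicalˡ _ _ ii
        j→i : Arc o (v j) (v i)
        j→i = trans (agrees j i (earlier⇒< ej) (earlier⇒< ei)
                      (earlier-clique k j i ej ei λ { refl → <-irrefl refl Rj<Ri }))
                    (<⇒<ᵇ' Rj<Ri)

      lower-closed : ∀ i j → lower i ≡ true → earlier k j ≡ true → R j < R i → lower j ≡ true
      lower-closed i j li ej Rj<Ri rewrite ej = <⇒<ᵇ' (<-trans Rj<Ri (<ᵇ'⇒< (R i) P (∧-conicalʳ _ _ li)))

      same-size : card into ≡ card lower
      same-size = trans (≡-sym (c≡inDeg k)) (≡-sym (insertionRank-spec k R R-ranking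
        (subst (_≤ card (earlier k)) (≡-sym (c≡inDeg k)) (inDeg-≤ o k))))

      arcs-into : ∀ l → earlier k l ≡ true → arc o (v l) (v k) ≡ (R l <ᵇ' P)
      arcs-into l el = trans (cong (_∧ arc o (v l) (v k)) (≡-sym el))
        (trans (downSets-≡ ((λ i → ∧-conicalˡ _ _) , into-closed)
                           ((λ i → ∧-conicalˡ _ _) , lower-closed) same-size l)
               (cong (_∧ (R l <ᵇ' P)) el))

    agrees-step : ∀ k → Agrees (toℕ k) → Agrees (suc (toℕ k))
    agrees-step k agrees j l j≤k l≤k e =
      trans by-insert (cong (λ R′ → R′ j <ᵇ' R′ l) (≡-sym (ranks-step k)))
      where
      R : Ranking n
      R = ranks (toℕ k)
      P : ℕ
      P = insertionRank k R
      by-insert : arc o (v j) (v l) ≡ (insert k R j <ᵇ' insert k R l)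
      by-insert with j Fin.≟ k | l Fin.≟ k
      ... | yes refl | yes refl = contradiction (trans (≡-sym (adj-irrefl G (v j))) e) (λ ())
      ... | yes refl | no l≢k = begin
        arc o (v k) (v l)        ≡⟨ arc-flip G o o-orientation (v k) (v l) e ⟩
        not (arc o (v l) (v k))  ≡⟨ cong not (ArcsInto.arcs-into k agrees l (earlier-intro (<suc-≢⇒< l≤k l≢k) e)) ⟩
        not (R l <ᵇ' P)          ≡⟨ ≡-sym (P-<ᵇ'-shift P (R l)) ⟩
        P <ᵇ' shift P (R l)      ∎
        where open ≡-Reasoning
      ... | no j≢k | yes refl = trans
        (ArcsInto.arcs-into k agrees j (earlier-intro (<suc-≢⇒< j≤k j≢k) (trans (adj-sym G (v k) (v j)) e)))
        (≡-sym (shift-<ᵇ'-P P (R j)))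
      ... | no j≢k | no l≢k = trans (agrees j l (<suc-≢⇒< j≤k j≢k) (<suc-≢⇒< l≤k l≢k) e)
        (≡-sym (shift-<ᵇ' P (R j) (R l)))

    agrees : ∀ m → m ≤ n → Agrees m
    agrees zero    _   j l ()
    agrees (suc m) m<n with fromℕ< m<n | toℕ-fromℕ< m<n
    ... | k | refl = agrees-step k (agrees (toℕ k) (<⇒≤ m<n))

    decode-complete : decode ≡ o
    decode-complete = matrix-ext decode o same-arcs
      where
      same-arcs : ∀ u w → arc decode u w ≡ arc o u w
      same-arcs u w rewrite arc-rankOrientation G (finalRanks ∘ pos) u w with adj G u w in e
      ... | false = ≡-sym (arc-nonEdge G o o-orientation u w e)
      ... | true  = ≡-sym (subst₂ (λ x y → arc o x y ≡ (finalRanks (pos u) <ᵇ' finalRanks (pos w)))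
        (v-pos u) (v-pos w)
        (agrees n ≤-refl (pos u) (pos w) (toℕ<n _) (toℕ<n _)
          (subst₂ (Adj G) (≡-sym (v-pos u)) (≡-sym (v-pos w)) e)))

reflectIf : Bool → ℕ → ℕ → ℕ
reflectIf false e a = a
reflectIf true  e a = e ∸ a

reflectIf-≤ : ∀ s {e a} → a ≤ e → reflectIf s e a ≤ e
reflectIf-≤ false a≤e = a≤e
reflectIf-≤ true  {e} {a} _ = m∸n≤m e a

reflectIf-involutive : ∀ s {e a} → a ≤ e → reflectIf s e (reflectIf s e a) ≡ a
reflectIf-involutive false _   = refl
reflectIf-involutive true  a≤e = m∸[m∸n]≡n a≤e

module Descents {n} (G : Graph n) (σ : Permutation′ n) where
  open Positions G σ

  descent : Orientation n → Fin n → Fin n → ℕ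
  descent o i j = ind ((toℕ j <ᵇ' toℕ i) ∧ arc o i j)

  des-∑ : ∀ o → des o ≡ ∑ (λ i → ∑ (descent o i))
  des-∑ o = trans (sum-map-tabulate (λ i → count (λ j → (toℕ j <ᵇ' toℕ i) ∧ arc o i j) (allFin n)) id)
                  (∑-cong (λ i → count-allFin (λ j → (toℕ j <ᵇ' toℕ i) ∧ arc o i j)))

  descent-pair : ∀ o x y → toℕ y < toℕ x → descent o x y + descent o y x ≡ ind (arc o x y)
  descent-pair o x y y<x rewrite <⇒<ᵇ' y<x | ≥⇒≮ᵇ' (<⇒≤ y<x) = +-identityʳ _

  descent-diagonal : ∀ o x → descent o x x ≡ 0
  descent-diagonal o x rewrite ≥⇒≮ᵇ' (≤-refl {toℕ x}) = refl

  module _ (o : Orientation n) (o-orientation : IsOrientation G o) where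

    outDeg : Fin n → ℕ
    outDeg k = card (λ j → earlier k j ∧ arc o (v k) (v j))

    inDeg+outDeg : ∀ k → inDeg o k + outDeg k ≡ card (earlier k)
    inDeg+outDeg k = trans (≡-sym (∑-distrib-+ (λ j → ind (earlier k j ∧ arc o (v j) (v k)))
                                                (λ j → ind (earlier k j ∧ arc o (v k) (v j)))))
                             (∑-cong pointwise)
      where
      pointwise : ∀ j → ind (earlier k j ∧ arc o (v j) (v k)) + ind (earlier k j ∧ arc o (v k) (v j)) ≡
                        ind (earlier k j)
      pointwise j with earlier k j in e
      ... | false = refl
      ... | true rewrite arc-flip G o o-orientation (v k) (v j) (∧-conicalʳ _ _ e)
        with arc o (v j) (v k)
      ...   | true  = refl
      ...   | false = refl

    descentsAt : Fin n → Fin n → ℕ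
    descentsAt k b = when (toℕ b <ᵇ' toℕ k) (descent o (v k) (v b) + descent o (v b) (v k))

    descentsAt-greater : ∀ k → (∀ j → toℕ j < toℕ k → Adj G (v k) (v j) → toℕ (v k) < toℕ (v j)) →
      ∀ b → descentsAt k b ≡ ind (earlier k b ∧ arc o (v b) (v k))
    descentsAt-greater k greater b with toℕ b <ᵇ' toℕ k in b<k | adj G (v k) (v b) in e
    ... | false | _     = refl
    ... | true  | true  = trans (+-comm (descent o (v k) (v b)) _)
      (descent-pair o (v b) (v k) (greater b (<ᵇ'⇒< _ _ b<k) e))
    ... | true  | false rewrite arc-nonEdge G o o-orientation (v k) (v b) e
                              | arc-nonEdge G o o-orientation (v b) (v k) (trans (adj-sym G (v b) (v k)) e)
                              | ∧-zeroʳ (toℕ (v b) <ᵇ' toℕ (v k))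
                              | ∧-zeroʳ (toℕ (v k) <ᵇ' toℕ (v b)) = refl

    descentsAt-smaller : ∀ k → (∀ j → toℕ j < toℕ k → Adj G (v k) (v j) → toℕ (v j) < toℕ (v k)) →
      ∀ b → descentsAt k b ≡ ind (earlier k b ∧ arc o (v k) (v b))
    descentsAt-smaller k smaller b with toℕ b <ᵇ' toℕ k in b<k | adj G (v k) (v b) in e
    ... | false | _     = refl
    ... | true  | true  = descent-pair o (v k) (v b) (smaller b (<ᵇ'⇒< _ _ b<k) e)
    ... | true  | false rewrite arc-nonEdge G o o-orientation (v k) (v b) e
                              | arc-nonEdge G o o-orientation (v b) (v k) (trans (adj-sym G (v b) (v k)) e)
                              | ∧-zeroʳ (toℕ (v b) <ᵇ' toℕ (v k))
                              | ∧-zeroʳ (toℕ (v k) <ᵇ' toℕ (v b)) = refl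

  module _ (nice : IsNicePEO G σ) where

    smallerSide : Fin n → Bool
    smallerSide k = [ const false , const true ]′ (proj₂ nice k)

    des-formula : ∀ o → IsOrientation G o →
      des o ≡ ∑ (λ k → reflectIf (smallerSide k) (card (earlier k)) (inDeg o k))
    des-formula o o-orientation = begin
      des o
        ≡⟨ des-∑ o ⟩
      ∑ (λ i → ∑ (descent o i))
        ≡⟨ ∑-permute (λ i → ∑ (descent o i)) σ ⟩
      ∑ (λ a → ∑ (descent o (v a)))
        ≡⟨ ∑-cong (λ a → ∑-permute (descent o (v a)) σ) ⟩
      ∑ (λ a → ∑ (λ b → descent o (v a) (v b)))
        ≡⟨ ∑∑-lowerTriangle (λ a b → descent o (v a) (v b)) (λ a → descent-diagonal o (v a)) ⟩
      ∑ (λ k → ∑ (descentsAt o o-orientation k))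
        ≡⟨ ∑-cong at-position ⟩
      ∑ (λ k → reflectIf (smallerSide k) (card (earlier k)) (inDeg o k)) ∎
      where
      open ≡-Reasoning
      at-position : ∀ k → ∑ (descentsAt o o-orientation k) ≡
                          reflectIf (smallerSide k) (card (earlier k)) (inDeg o k)
      at-position k with proj₂ nice k
      ... | inj₁ greater = ∑-cong (descentsAt-greater o o-orientation k greater)
      ... | inj₂ smaller = trans (∑-cong (descentsAt-smaller o o-orientation k smaller))
        (≡-sym (trans (cong (_∸ inDeg o k) (≡-sym (inDeg+outDeg o o-orientation k)))
                      (m+n∸m≡n (inDeg o k) _)))

map-unique-on : ∀ {A B : Set} (f : A → B) {xs : List A} →
  (∀ {x y} → x ∈ xs → y ∈ xs → f x ≡ f y → x ≡ y) → Unique xs → Unique (map f xs)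
map-unique-on f {[]}     _        []         = []
map-unique-on f {x ∷ xs} injective (x∉ ∷ u) =
  distinct xs (λ y∈ → y∈) x∉ ∷ map-unique-on f (λ a b → injective (there a) (there b)) u
  where
  distinct : ∀ ys → (∀ {y} → y ∈ ys → y ∈ xs) → All (λ y → ¬ x ≡ y) ys → All (λ z → ¬ f x ≡ z) (map f ys)
  distinct []       _   []         = []
  distinct (y ∷ ys) ys⊆ (x≢y ∷ ps) =
    (λ e → x≢y (injective (here refl) (there (ys⊆ (here refl))) e)) ∷ distinct ys (ys⊆ ∘ there) ps

vec-sum-∑ : ∀ {m} (c : Vec ℕ m) → Vec.sum c ≡ ∑ (lookup c)
vec-sum-∑ []ᵥ       = refl
vec-sum-∑ (a ∷ᵥ c) = cong (a +_) (vec-sum-∑ c)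

-- Acyclic orientations with K descents correspond to the vectors c
-- bounded by the earlier degrees with entry sum K: c k counts the descents
-- at position k, which determines the in-degree at k.
module Correspondence {n} (G : Graph n) (σ : Permutation′ n) (nice : IsNicePEO G σ) where
  open Positions G σ
  open Descents G σ

  bounds : Vec ℕ n
  bounds = tabulate (earlierDeg G σ)

  bounds-lookup : ∀ k → lookup bounds k ≡ card (earlier k)
  bounds-lookup k = trans (lookup∘tabulate (earlierDeg G σ) k) (earlierDeg-card k)

  reflectAt : Fin n → ℕ → ℕ
  reflectAt k = reflectIf (smallerSide nice k) (card (earlier k))

  reflectAt-≤ : ∀ k {a} → a ≤ card (earlier k) → reflectAt k a ≤ card (earlier k)
  reflectAt-≤ k = reflectIf-≤ (smallerSide nice k)

  reflectAt-involutive : ∀ k {a} → a ≤ card (earlier k) → reflectAt k (reflectAt k a) ≡ a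
  reflectAt-involutive k = reflectIf-involutive (smallerSide nice k)

  inDegs : Vec ℕ n → Fin n → ℕ
  inDegs c k = reflectAt k (lookup c k)

  fromDescents : Vec ℕ n → Orientation n
  fromDescents c = Decode.decode (inDegs c)

  codes : ℕ → List (Vec ℕ n)
  codes K = filter (λ c → Vec.sum c ≟ K) (box bounds)

  module _ {c : Vec ℕ n} (c∈box : c ∈ box bounds) where

    bounded : ∀ k → lookup c k ≤ card (earlier k)
    bounded k = subst (lookup c k ≤_) (bounds-lookup k) (∈-box⁻ bounds c∈box k)

    fromDescents-inDeg : ∀ k → inDeg (fromDescents c) k ≡ inDegs c k
    fromDescents-inDeg = Decode.decode-inDeg (inDegs c) (λ k → reflectAt-≤ k (bounded k))

    fromDescents-recovers : ∀ k → reflectAt k (inDeg (fromDescents c) k) ≡ lookup c k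
    fromDescents-recovers k =
      trans (cong (reflectAt k) (fromDescents-inDeg k)) (reflectAt-involutive k (bounded k))

    fromDescents-des : des (fromDescents c) ≡ Vec.sum c
    fromDescents-des = begin
      des (fromDescents c)
        ≡⟨ des-formula nice (fromDescents c) (Decode.decode-isOrientation (inDegs c)) ⟩
      ∑ (λ k → reflectAt k (inDeg (fromDescents c) k))
        ≡⟨ ∑-cong fromDescents-recovers ⟩
      ∑ (lookup c)
        ≡⟨ ≡-sym (vec-sum-∑ c) ⟩
      Vec.sum c ∎
      where open ≡-Reasoning

  fromDescents-injective : ∀ {c c′} → c ∈ box bounds → c′ ∈ box bounds →
    fromDescents c ≡ fromDescents c′ → c ≡ c′
  fromDescents-injective {c} {c′} c∈ c′∈ same = vec-ext c c′ λ k → trans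
    (≡-sym (fromDescents-recovers c∈ k))
    (trans (cong (λ o → reflectAt k (inDeg o k)) same) (fromDescents-recovers c′∈ k))

  toDescents : Orientation n → Vec ℕ n
  toDescents o = tabulate (λ k → reflectAt k (inDeg o k))

  module _ (o : Orientation n) (o-orientation : IsOrientation G o) (o-acyclic : IsAcyclic o) where

    toDescents-lookup : ∀ k → lookup (toDescents o) k ≡ reflectAt k (inDeg o k)
    toDescents-lookup = lookup∘tabulate (λ k → reflectAt k (inDeg o k))

    toDescents∈box : toDescents o ∈ box bounds
    toDescents∈box = ∈-box⁺ bounds (toDescents o) λ k →
      subst₂ _≤_ (≡-sym (toDescents-lookup k)) (≡-sym (bounds-lookup k)) (reflectAt-≤ k (inDeg-≤ o k))

    toDescents-sum : Vec.sum (toDescents o) ≡ des o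
    toDescents-sum = trans (vec-sum-∑ (toDescents o))
      (trans (∑-cong toDescents-lookup) (≡-sym (des-formula nice o o-orientation)))

    fromDescents-toDescents : fromDescents (toDescents o) ≡ o
    fromDescents-toDescents = Encode.decode-complete (proj₁ nice) o-orientation o-acyclic _ λ k →
      trans (cong (reflectAt k) (toDescents-lookup k)) (reflectAt-involutive k (inDeg-≤ o k))

  decoded-unique : ∀ K → Unique (map fromDescents (codes K))
  decoded-unique K = map-unique-on fromDescents
    (λ c∈ c′∈ → fromDescents-injective (in-box c∈) (in-box c′∈))
    (filter⁺ (λ c → Vec.sum c ≟ K) (box-unique bounds))
    where
    in-box : ∀ {c} → c ∈ codes K → c ∈ box bounds
    in-box = proj₁ ∘ ∈-filter⁻ (λ c → Vec.sum c ≟ K)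

  decoded-sound : ∀ K o → o ∈ map fromDescents (codes K) →
    IsOrientation G o × IsAcyclic o × des o ≡ K
  decoded-sound K o o∈ with ∈-map⁻ fromDescents o∈
  ... | c , c∈codes , refl with ∈-filter⁻ (λ c → Vec.sum c ≟ K) c∈codes
  ...   | c∈box , sum≡K = Decode.decode-isOrientation (inDegs c) , Decode.decode-acyclic (inDegs c) ,
                          trans (fromDescents-des c∈box) sum≡K

  decoded-complete : ∀ K o → IsOrientation G o × IsAcyclic o × des o ≡ K →
    o ∈ map fromDescents (codes K)
  decoded-complete K o (o-orientation , o-acyclic , des≡K) =
    subst (_∈ map fromDescents (codes K)) (fromDescents-toDescents o o-orientation o-acyclic)
      (∈-map⁺ fromDescents (∈-filter⁺ (λ c → Vec.sum c ≟ K) (toDescents∈box o o-orientation o-acyclic)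
        (trans (toDescents-sum o o-orientation o-acyclic) des≡K)))

corollary5p6 : (n : ℕ) (G : Graph n) (σ : Permutation′ n) → IsNicePEO G σ →
    (k : ℕ) →
    Σ (List (Vec (Vec Bool n) n)) (λ L →
      Unique L ×
      (∀ o → (o ∈ L) ⇔ (IsOrientation G o × IsAcyclic o × des o ≡ k)) ×
      length L ≡ coeff (foldr _⊛_ (1 ∷ []) (map (λ i → qInt (earlierDeg G σ i + 1)) (allFin n))) k)
corollary5p6 n G σ nice K =
    map fromDescents (codes K)
  , decoded-unique K
  , (λ o → mk⇔ (decoded-sound K o) (decoded-complete K o))
  , (begin
      length (map fromDescents (codes K))  ≡⟨ length-map fromDescents (codes K) ⟩
      length (codes K)                     ≡⟨ count-box bounds K ⟩
      coeff (qProduct bounds) K            ≡⟨ cong (λ P → coeff P K) (qProduct-tabulate (earlierDeg G σ)) ⟩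
      coeff (foldr _⊛_ (1 ∷ []) (map (λ i → qInt (earlierDeg G σ i + 1)) (allFin n))) K ∎)
  where
  open Correspondence G σ nice
  open ≡-Reasoning
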